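{- Let $G$ be a graph with $n$ vertices consisting of a $2$-connected graph $H$ together with one additional vertex $v$ of degree one adjacent to a vertex of $H$. Let $I=(G,S,\Pi)$ be a pebble permutation instance with $p\le n-2$ pebbles. Then $I$ is feasible.
   Context: Pebbles are labeled $1,\dots,p$. A configuration is an injective map $S:\{1,\dots,p\}\to V(G)$, written $S=\langle s_1,\dots,s_p\rangle$. A move is a pair of configurations differing at exactly one pebble $i$, with $(s_i,s_i')$ an edge. Two configurations are connected if one is obtained from the other by a finite sequence of moves. A pebble permutation instance $(G,S,\Pi)$, with $\Pi$ any permutation of $\{1,\dots,p\}$, is feasible if $S$ is connected to the configuration $D$ with $d_i=s_{\Pi(i)}$ for all $i$. -}

module Defs where

open import Data.Nat using (ℕ; zero; suc; _≤_)
open import Data.Fin using (Fin; punchIn)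
open import Data.Fin.Permutation using (Permutation′; _⟨$⟩ʳ_)
open import Data.Product using (Σ; _×_; ∃; proj₁)
open import Data.Empty using (⊥)
open import Relation.Nullary using (¬_)
open import Relation.Binary.PropositionalEquality using (_≡_)
open import Relation.Binary.Construct.Closure.ReflexiveTransitive using (Star)
open import Function.Definitions using (Injective)

Graph : ℕ → Set₁
Graph n = Fin n → Fin n → Set

IsSimple : ∀ {n} → Graph n → Set
IsSimple {n} E = (∀ {a b : Fin n} → E a b → E b a) × (∀ {a : Fin n} → ¬ E a a)

Connected : ∀ {n} → Graph n → Set
Connected {n} E = (a b : Fin n) → Star E a b

deleteV : ∀ {m} → Graph (suc m) → Fin (suc m) → Graph m
deleteV E v i j = E (punchIn v i) (punchIn v j)

TwoConnected : ∀ {m} → Graph m → Set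
TwoConnected {zero} E = ⊥
TwoConnected {suc k} E = (3 ≤ suc k) × Connected E × ((x : Fin (suc k)) → Connected (deleteV E x))

DegreeOne : ∀ {n} → Graph n → Fin n → Set
DegreeOne {n} E v = ∃ λ (u : Fin n) → E v u × ((w : Fin n) → E v w → w ≡ u)

Config : ℕ → ℕ → Set
Config p n = Σ (Fin p → Fin n) (λ s → Injective _≡_ _≡_ s)

cfg : ∀ {p n} → Config p n → Fin p → Fin n
cfg = proj₁

Move : ∀ {p n} → Graph n → Config p n → Config p n → Set
Move {p} E S T = ∃ λ (i : Fin p) → E (cfg S i) (cfg T i) × ((j : Fin p) → ¬ (j ≡ i) → cfg S j ≡ cfg T j)

ConfConnected : ∀ {p n} → Graph n → Config p n → Config p n → Set
ConfConnected E = Star (Move E)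

Feasible : ∀ {p n} → Graph n → Config p n → Permutation′ p → Set
Feasible {p} {n} E S Π =
  Σ (Config p n) λ D → ((i : Fin p) → cfg D i ≡ cfg S (Π ⟨$⟩ʳ i)) × ConfConnected E S D

module Submission where

-- Every permutation is a product of transpositions (the library's
-- 'decompose'), so it suffices to exchange two pebbles a ≠ b.  Moves are
-- reversible and commute with relabelling the pebbles, so an exchange may
-- be performed from any reachable configuration (conjugation).  We first
-- bring a to v and b to u, carrying a pebble through H by repeatedly
-- vacating its next vertex with a hole sent through H minus its current
-- vertex (connected by 2-connectivity).  Then b steps to a neighbour w of u,
-- a hole is brought to a second neighbour y of u along a walk in H − w, and
-- on the star with centre u and leaves v, w, y six moves exchange a and b.

open import Defs
open import Level using (0ℓ)
open import Data.Nat using (ℕ; zero; suc; _<_; _≤_; _∸_; s≤s)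
open import Data.Nat.Properties using (<-trans; n<1+n)
open import Data.Fin using (Fin; zero; suc; punchIn; punchOut)
open import Data.Fin.Properties
  using (_≟_; any?; all?; <⇒notInjective; punchInᵢ≢i; punchIn-injective; punchIn-punchOut)
open import Data.Fin.Permutation using (Permutation′; _⟨$⟩ʳ_; _⟨$⟩ˡ_; inverseʳ; inverseˡ; transpose)
import Data.Fin.Permutation.Components as PC
open import Data.Fin.Permutation.Transposition.List using (TranspositionList; eval; decompose; eval-decompose)
open import Data.Vec.Functional using (updateAt)
open import Data.Vec.Functional.Properties using (updateAt-updates; updateAt-minimal)
open import Data.List using ([]; _∷_)
open import Data.Product using (Σ; _×_; ∃; proj₁; proj₂; _,_)
open import Data.Sum using (_⊎_; inj₁; inj₂; [_,_]′)
open import Data.Empty using (⊥-elim)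
open import Function using (_∘_; const)
open import Relation.Nullary using (Dec; yes; no; ¬?; contradiction)
open import Relation.Unary using (Pred; _∈_; _∉_; _∪_; _⊆_; ｛_｝)
open import Relation.Binary.PropositionalEquality using (_≡_; _≢_; refl; sym; trans; cong; subst)
open import Relation.Binary.Construct.Closure.ReflexiveTransitive using (Star; ε; _◅_; _◅◅_; gmap; reverse)
open import Function.Definitions using (Injective)

transpose-matchˡ : ∀ {p} (a b : Fin p) → PC.transpose a b a ≡ b
transpose-matchˡ a b with a ≟ a
... | yes _ = refl
... | no a≢a = contradiction refl a≢a

transpose-matchʳ : ∀ {p} (a b : Fin p) → PC.transpose a b b ≡ a
transpose-matchʳ a b with b ≟ a
... | yes b≡a = b≡a
... | no _ with b ≟ b
...   | yes _ = refl
...   | no b≢b = contradiction refl b≢b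

transpose-other : ∀ {p} {a b k : Fin p} → k ≢ a → k ≢ b → PC.transpose a b k ≡ k
transpose-other {a = a} {b} {k} k≢a k≢b with k ≟ a
... | yes k≡a = contradiction k≡a k≢a
... | no _ with k ≟ b
...   | yes k≡b = contradiction k≡b k≢b
...   | no _ = refl

transpose-self : ∀ {p} (a k : Fin p) → PC.transpose a a k ≡ k
transpose-self a k = bySplit (k ≟ a)
  where
  bySplit : Dec (k ≡ a) → PC.transpose a a k ≡ k
  bySplit (yes refl) = transpose-matchˡ a a
  bySplit (no k≢a) = transpose-other k≢a k≢a

firstEdge : ∀ {A : Set} {R : A → A → Set} {x y : A} → Star R x y → x ≢ y → ∃ (R x)
firstEdge ε x≢x = contradiction refl x≢x
firstEdge (edge ◅ _) _ = _ , edge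

edge-distinct : ∀ {n} {E : Graph n} → IsSimple E → ∀ {x y} → E x y → x ≢ y
edge-distinct {E = E} simple {x} edge x≡y = proj₂ simple (subst (E x) (sym x≡y) edge)

unpunch : ∀ {m} (w z : Fin (suc m)) → z ≢ w → ∃ λ i → punchIn w i ≡ z
unpunch w z z≢w = punchOut (z≢w ∘ sym) , punchIn-punchOut (z≢w ∘ sym)

module _ {p n : ℕ} where

  Free : Config p n → Fin n → Set
  Free R z = ∀ c → cfg R c ≢ z

  _≋_ : Config p n → Config p n → Set
  R ≋ T = ∀ i → cfg R i ≡ cfg T i

  relabel : Config p n → Permutation′ p → Config p n
  relabel R π = cfg R ∘ (π ⟨$⟩ʳ_) , λ same → permutation-injective (proj₂ R same)
    where
    permutation-injective : Injective _≡_ _≡_ (π ⟨$⟩ʳ_)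
    permutation-injective {i} {j} πi≡πj = trans (sym (inverseˡ π)) (trans (cong (π ⟨$⟩ˡ_) πi≡πj) (inverseˡ π))

  record Relocates (R : Config p n) (c : Fin p) (y : Fin n) (R′ : Config p n) : Set where
    field
      arrives : cfg R′ c ≡ y
      stays   : ∀ j → j ≢ c → cfg R′ j ≡ cfg R j
  open Relocates

  moveTo : (R : Config p n) (c : Fin p) (y : Fin n) → Free R y → Σ (Config p n) (Relocates R c y)
  moveTo R c y y-free = (moved , injective) , record { arrives = arrives′ ; stays = stays′ }
    where
    moved : Fin p → Fin n
    moved = updateAt (cfg R) c (const y)
    arrives′ : moved c ≡ y
    arrives′ = updateAt-updates c (cfg R)
    stays′ : ∀ j → j ≢ c → moved j ≡ cfg R j
    stays′ j j≢c = updateAt-minimal j c (cfg R) j≢c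
    injective : Injective _≡_ _≡_ moved
    injective {i} {j} same with i ≟ c | j ≟ c
    ... | yes refl | yes refl = refl
    ... | yes refl | no j≢c = ⊥-elim (y-free j (trans (sym (stays′ j j≢c)) (trans (sym same) arrives′)))
    ... | no i≢c | yes refl = ⊥-elim (y-free i (trans (sym (stays′ i i≢c)) (trans same arrives′)))
    ... | no i≢c | no j≢c = proj₂ R (trans (sym (stays′ i i≢c)) (trans same (stays′ j j≢c)))

  relocates-free : ∀ {R R′ c y z} → Relocates R c y R′ → z ≢ y → Free R z ⊎ cfg R c ≡ z → Free R′ z
  relocates-free {R} {c = c} {z = z} reloc z≢y before j j-at-z with j ≟ c
  ... | yes refl = z≢y (trans (sym j-at-z) (arrives reloc))
  ... | no j≢c = [ (λ z-free → z-free j was-at-z) , (λ c-at-z → j≢c (proj₂ R (trans was-at-z (sym c-at-z)))) ]′ before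
    where
    was-at-z : cfg R j ≡ z
    was-at-z = trans (sym (stays reloc j j≢c)) j-at-z

  relocates-trans : ∀ {R R₁ R₂ c m y} → Relocates R c m R₁ → Relocates R₁ c y R₂ → Relocates R c y R₂
  relocates-trans first second = record
    { arrives = arrives second
    ; stays = λ j j≢c → trans (stays second j j≢c) (stays first j j≢c) }

-- With fewer pebbles than vertices some vertex is free: otherwise "the
-- pebble on z" would inject the vertices into the pebbles.
freeVertex : ∀ {p n} (R : Config p n) → p < n → ∃ (Free R)
freeVertex {p} {n} R p<n with any? (λ z → all? (λ c → ¬? (cfg R c ≟ z)))
... | yes free = free
... | no noneFree = ⊥-elim (<⇒notInjective p<n occupant-injective)
  where
  occupant : (z : Fin n) → ∃ λ c → cfg R c ≡ z
  occupant z with any? (λ c → cfg R c ≟ z)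
  ... | yes occupied = occupied
  ... | no unoccupied = contradiction (z , λ c at-z → unoccupied (c , at-z)) noneFree
  occupant-injective : Injective _≡_ _≡_ (proj₁ ∘ occupant)
  occupant-injective {z} {z′} same =
    trans (sym (proj₂ (occupant z))) (trans (cong (cfg R) same) (proj₂ (occupant z′)))

-- With two more vertices than pebbles, some free vertex differs from any
-- given x: if x is free, place a phantom pebble on it and count again.
freeVertexBesides : ∀ {p n} (R : Config p n) → suc p < n → (x : Fin n) → ∃ λ z → Free R z × z ≢ x
freeVertexBesides {p} {n} R sp<n x with any? (λ c → cfg R c ≟ x)
... | yes (c , c-at-x) =
  let (z , z-free) = freeVertex R (<-trans (n<1+n p) sp<n)
  in z , z-free , λ z≡x → z-free c (trans c-at-x (sym z≡x))
... | no x-free =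
  let (z , z-free) = freeVertex withPhantom sp<n
  in z , (λ c → z-free (suc c)) , λ z≡x → z-free zero (sym z≡x)
  where
  withPhantom : Config (suc p) n
  withPhantom = place , injective
    where
    place : Fin (suc p) → Fin n
    place zero = x
    place (suc c) = cfg R c
    injective : Injective _≡_ _≡_ place
    injective {zero} {zero} _ = refl
    injective {zero} {suc j} x≡ = contradiction (j , sym x≡) x-free
    injective {suc i} {zero} ≡x = contradiction (i , ≡x) x-free
    injective {suc i} {suc j} same = cong suc (proj₂ R same)

module Motion {n : ℕ} (E : Graph n) (simple : IsSimple E) {p : ℕ} where

  open Relocates

  symE : ∀ {x y} → E x y → E y x
  symE = proj₁ simple

  jump : ∀ {R R′ : Config p n} {c y} → Relocates R c y R′ → E (cfg R c) y → Star (Move E) R R′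
  jump {R} {c = c} reloc edge =
    (c , subst (E (cfg R c)) (sym (arrives reloc)) edge , λ j j≢c → sym (stays reloc j j≢c)) ◅ ε

  move-sym : ∀ {S T : Config p n} → Move E S T → Move E T S
  move-sym (i , edge , others) = i , symE edge , λ j j≢i → sym (others j j≢i)

  move-≋ : ∀ {S S′ T : Config p n} → S ≋ S′ → Move E S T → Move E S′ T
  move-≋ {T = T} S≋S′ (i , edge , others) =
    i , subst (λ z → E z (cfg T i)) (S≋S′ i) edge , λ j j≢i → trans (sym (S≋S′ j)) (others j j≢i)

  move-relabel : ∀ {S T : Config p n} (π : Permutation′ p) → Move E S T → Move E (relabel S π) (relabel T π)
  move-relabel {S} {T} π (i , edge , others) =
    π ⟨$⟩ˡ i , subst (λ k → E (cfg S k) (cfg T k)) (sym (inverseʳ π)) edge ,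
    λ j j≢ → others (π ⟨$⟩ʳ j) (λ πj≡i → j≢ (trans (sym (inverseˡ π)) (cong (π ⟨$⟩ˡ_) πj≡i)))

  record Reach (R T : Config p n) : Set where
    constructor reach
    field
      end   : Config p n
      moves : Star (Move E) R end
      lands : end ≋ T

  moves⇒reach : ∀ {R T : Config p n} → Star (Move E) R T → Reach R T
  moves⇒reach moves = reach _ moves λ _ → refl

  restart : ∀ {S S′ T : Config p n} → S ≋ S′ → Star (Move E) S T → Reach S′ T
  restart S≋S′ ε = reach _ ε λ i → sym (S≋S′ i)
  restart {S} {S′} S≋S′ (_◅_ {j = X} move moves) = moves⇒reach (move-≋ {S} {S′} {X} S≋S′ move ◅ moves)

  reach-≋ : ∀ {R T T′ : Config p n} → Reach R T → T ≋ T′ → Reach R T′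
  reach-≋ (reach end moves lands) T≋T′ = reach end moves λ i → trans (lands i) (T≋T′ i)

  reach-trans : ∀ {R S T : Config p n} → Reach R S → Reach S T → Reach R T
  reach-trans (reach S′ moves₁ S′≋S) (reach _ moves₂ lands₂) =
    let reach T′ moves₃ T′≋ = restart (λ i → sym (S′≋S i)) moves₂
    in reach T′ (moves₁ ◅◅ moves₃) λ i → trans (T′≋ i) (lands₂ i)

  reach-sym : ∀ {R S : Config p n} → Reach R S → Reach S R
  reach-sym (reach S′ moves S′≋S) = restart S′≋S (reverse (λ {X} {Y} → move-sym {X} {Y}) moves)

  reach-relabel : ∀ {R T : Config p n} (π : Permutation′ p) → Reach R T → Reach (relabel R π) (relabel T π)
  reach-relabel π (reach end moves lands) =
    reach (relabel end π) (gmap (λ R → relabel R π) (λ {X} {Y} → move-relabel {X} {Y} π) moves) λ i → lands (π ⟨$⟩ʳ i)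

  -- Conjugation: a relabelling realised from some configuration reachable
  -- from R is realised from R as well (go there, relabel, come back).
  conjugate : ∀ {R Y : Config p n} (π : Permutation′ p) → Reach R Y → Reach Y (relabel Y π) → Reach R (relabel R π)
  conjugate π R→Y Y→πY = reach-trans R→Y (reach-trans Y→πY (reach-relabel π (reach-sym R→Y)))

  realise-permutations : (∀ R (a b : Fin p) → a ≢ b → Reach R (relabel R (transpose a b))) →
                         ∀ R (π : Permutation′ p) → Reach R (relabel R π)
  realise-permutations swap R π =
    reach-≋ (realise-list (decompose π) R) λ i → cong (cfg R) (eval-decompose π i)
    where
    realise-transposition : ∀ R (a b : Fin p) → Reach R (relabel R (transpose a b))
    realise-transposition R a b with a ≟ b
    ... | yes refl = reach R ε λ i → cong (cfg R) (sym (transpose-self a i))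
    ... | no a≢b = swap R a b a≢b
    realise-list : (xs : TranspositionList p) → ∀ R → Reach R (relabel R (eval xs))
    realise-list [] R = reach R ε λ _ → refl
    realise-list ((a , b) ∷ xs) R =
      reach-trans (realise-list xs R) (reach-≋ (realise-transposition (relabel R (eval xs)) a b) λ _ → refl)

  record Fixes (A : Pred (Fin n) 0ℓ) (R R′ : Config p n) : Set where
    constructor fixing
    field route : ∀ c → cfg R′ c ≡ cfg R c ⊎ (cfg R c ∉ A × cfg R′ c ∉ A)
  open Fixes

  fixes-refl : ∀ {A R} → Fixes A R R
  fixes-refl = fixing λ _ → inj₁ refl

  fixes-trans : ∀ {A R R₁ R₂} → Fixes A R R₁ → Fixes A R₁ R₂ → Fixes A R R₂
  fixes-trans {A} first second = fixing λ c → compose (route first c) (route second c)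
    where
    compose : ∀ {x y z} → y ≡ x ⊎ (x ∉ A × y ∉ A) → z ≡ y ⊎ (y ∉ A × z ∉ A) → z ≡ x ⊎ (x ∉ A × z ∉ A)
    compose (inj₁ y≡x) (inj₁ z≡y) = inj₁ (trans z≡y y≡x)
    compose (inj₁ y≡x) (inj₂ (y∉A , z∉A)) = inj₂ (subst (_∉ A) y≡x y∉A , z∉A)
    compose (inj₂ (x∉A , y∉A)) (inj₁ z≡y) = inj₂ (x∉A , subst (_∉ A) (sym z≡y) y∉A)
    compose (inj₂ (x∉A , _)) (inj₂ (_ , z∉A)) = inj₂ (x∉A , z∉A)

  fixes-mono : ∀ {A A′ R R′} → A′ ⊆ A → Fixes A R R′ → Fixes A′ R R′
  fixes-mono A′⊆A fixes = fixing λ c → [ inj₁ , (λ (x∉A , y∉A) → inj₂ (x∉A ∘ A′⊆A , y∉A ∘ A′⊆A)) ]′ (route fixes c)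

  fixes-stay : ∀ {A R R′ c z} → Fixes A R R′ → z ∈ A → cfg R c ≡ z → cfg R′ c ≡ z
  fixes-stay {A} {c = c} fixes z∈A at-z =
    [ (λ stayed → trans stayed at-z) , (λ (∉A , _) → contradiction (subst (_∈ A) (sym at-z) z∈A) ∉A) ]′ (route fixes c)

  fixes-free : ∀ {A R R′ z} → Fixes A R R′ → z ∈ A → Free R z → Free R′ z
  fixes-free {A} fixes z∈A z-free c at-z =
    [ (λ stayed → z-free c (trans (sym stayed) at-z)) , (λ (_ , ∉A) → contradiction (subst (_∈ A) (sym at-z) z∈A) ∉A) ]′ (route fixes c)

  relocation-fixes : ∀ {A R R′ c y} → Relocates R c y R′ → cfg R c ∉ A → y ∉ A → Fixes A R R′
  relocation-fixes {A} {R} {R′} {c} reloc from∉A y∉A = fixing route′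
    where
    route′ : ∀ j → cfg R′ j ≡ cfg R j ⊎ (cfg R j ∉ A × cfg R′ j ∉ A)
    route′ j with j ≟ c
    ... | yes refl = inj₂ (from∉A , subst (_∉ A) (sym (arrives reloc)) y∉A)
    ... | no j≢c = inj₁ (stays reloc j j≢c)

  OutsideEdge : Pred (Fin n) 0ℓ → Fin n → Fin n → Set
  OutsideEdge A x y = E x y × x ∉ A × y ∉ A

  WalkOutside : Pred (Fin n) 0ℓ → Fin n → Fin n → Set
  WalkOutside A = Star (OutsideEdge A)

  -- A hole travels along any walk outside A, each pebble on the walk
  -- stepping back into the hole; A is left undisturbed.
  moveHole : ∀ {A x y} → WalkOutside A x y → (R : Config p n) → Free R x →
             Σ (Config p n) λ R′ → Star (Move E) R R′ × Free R′ y × Fixes A R R′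
  moveHole ε R x-free = R , ε , x-free , fixes-refl
  moveHole {A} {x} (_◅_ {j = x′} (edge , x∉A , x′∉A) walk) R x-free with any? (λ c → cfg R c ≟ x′)
  ... | no x′-free = moveHole walk R λ c at → x′-free (c , at)
  ... | yes (c , c-at-x′) =
    let (R₁ , reloc) = moveTo R c x x-free
        x′-free = relocates-free reloc (λ x′≡x → x-free c (trans c-at-x′ x′≡x)) (inj₂ c-at-x′)
        (R′ , moves , y-free , fixes) = moveHole walk R₁ x′-free
    in R′ , jump reloc (subst (λ z → E z x) (sym c-at-x′) (symE edge)) ◅◅ moves , y-free ,
       fixes-trans (relocation-fixes reloc (subst (_∉ A) (sym c-at-x′) x′∉A) x∉A) fixes

  approach : ∀ {A h t} → WalkOutside A h t → h ≢ t → Σ (Fin n) λ y → WalkOutside (A ∪ ｛ t ｝) h y × E y t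
  approach ε h≢h = contradiction refl h≢h
  approach {A} {h} {t} (_◅_ {j = h′} (edge , h∉A , h′∉A) walk) h≢t with h′ ≟ t
  ... | yes refl = h , ε , edge
  ... | no h′≢t =
    let (y , walk′ , y-t) = approach walk h′≢t
    in y , (edge , [ h∉A , h≢t ∘ sym ]′ , [ h′∉A , h′≢t ∘ sym ]′) ◅ walk′ , y-t

  slide : (R : Config p n) (c : Fin p) {m y : Fin n} → Free R m → Free R y → E (cfg R c) m → E m y →
          Σ (Config p n) λ R′ → Star (Move E) R R′ × Relocates R c y R′
  slide R c {m} {y} m-free y-free edge₁ edge₂ =
    let (R₁ , reloc₁) = moveTo R c m m-free
        (R₂ , reloc₂) = moveTo R₁ c y (relocates-free reloc₁ (edge-distinct simple edge₂ ∘ sym) (inj₁ y-free))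
    in R₂ , jump reloc₁ edge₁ ◅◅ jump reloc₂ (subst (λ z → E z y) (sym (arrives reloc₁)) edge₂) ,
       relocates-trans reloc₁ reloc₂

  -- Sliding b to y, a to b's
  -- place and b to a's place (each time through u) exchanges a and b.
  starSwap : (R : Config p n) {a b : Fin p} → a ≢ b → {u y : Fin n} → Free R u → Free R y →
             E (cfg R a) u → E (cfg R b) u → E u y → Reach R (relabel R (transpose a b))
  starSwap R {a} {b} a≢b {u} {y} u-free y-free a-u b-u u-y =
    reach R₃ (proj₁ (proj₂ step₁) ◅◅ proj₁ (proj₂ step₂) ◅◅ proj₁ (proj₂ step₃)) swapped
    where
    x w : Fin n
    x = cfg R a
    w = cfg R b
    b≢a : b ≢ a
    b≢a = a≢b ∘ sym
    step₁ : Σ (Config p n) λ R′ → Star (Move E) R R′ × Relocates R b y R′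
    step₁ = slide R b u-free y-free b-u u-y
    R₁ : Config p n
    R₁ = proj₁ step₁
    reloc₁ : Relocates R b y R₁
    reloc₁ = proj₂ (proj₂ step₁)
    a-at-x₁ : cfg R₁ a ≡ x
    a-at-x₁ = stays reloc₁ a a≢b
    u-free₁ : Free R₁ u
    u-free₁ = relocates-free reloc₁ (edge-distinct simple u-y) (inj₁ u-free)
    step₂ : Σ (Config p n) λ R′ → Star (Move E) R₁ R′ × Relocates R₁ a w R′
    step₂ = slide R₁ a u-free₁ (relocates-free reloc₁ (λ w≡y → y-free b w≡y) (inj₂ refl))
                  (subst (λ z → E z u) (sym a-at-x₁) a-u) (symE b-u)
    R₂ : Config p n
    R₂ = proj₁ step₂
    reloc₂ : Relocates R₁ a w R₂
    reloc₂ = proj₂ (proj₂ step₂)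
    b-at-y₂ : cfg R₂ b ≡ y
    b-at-y₂ = trans (stays reloc₂ b b≢a) (arrives reloc₁)
    step₃ : Σ (Config p n) λ R′ → Star (Move E) R₂ R′ × Relocates R₂ b x R′
    step₃ = slide R₂ b (relocates-free reloc₂ (edge-distinct simple b-u ∘ sym) (inj₁ u-free₁))
                  (relocates-free reloc₂ (a≢b ∘ proj₂ R) (inj₂ a-at-x₁))
                  (subst (λ z → E z u) (sym b-at-y₂) (symE u-y)) (symE a-u)
    R₃ : Config p n
    R₃ = proj₁ step₃
    reloc₃ : Relocates R₂ b x R₃
    reloc₃ = proj₂ (proj₂ step₃)
    swapped : R₃ ≋ relabel R (transpose a b)
    swapped i = byCases (i ≟ b) (i ≟ a)
      where
      byCases : Dec (i ≡ b) → Dec (i ≡ a) → cfg R₃ i ≡ cfg R (PC.transpose a b i)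
      byCases (yes refl) _ = trans (arrives reloc₃) (cong (cfg R) (sym (transpose-matchʳ a b)))
      byCases (no i≢b) (yes refl) =
        trans (stays reloc₃ a a≢b) (trans (arrives reloc₂) (cong (cfg R) (sym (transpose-matchˡ a b))))
      byCases (no i≢b) (no i≢a) =
        trans (stays reloc₃ i i≢b) (trans (stays reloc₂ i i≢a)
          (trans (stays reloc₁ i i≢b) (cong (cfg R) (sym (transpose-other i≢a i≢b)))))

module Pendant {m : ℕ} (E : Graph (suc (suc (suc m)))) (simple : IsSimple E)
  (v : Fin (suc (suc (suc m))))
  (H-connected : Connected (deleteV E v))
  (H-2-connected : (x : Fin (suc (suc m))) → Connected (deleteV (deleteV E v) x))
  (u : Fin (suc (suc m))) (v-u : E v (punchIn v u))
  {p : ℕ} (p≤ : p ≤ suc m) where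

  open Motion E simple {p}
  open Relocates

  H : Graph (suc (suc m))
  H = deleteV E v

  ι : Fin (suc (suc m)) → Fin (suc (suc (suc m)))
  ι = punchIn v

  v≢ι : ∀ i → v ≢ ι i
  v≢ι i = punchInᵢ≢i v i ∘ sym

  Config′ : Set
  Config′ = Config p (suc (suc (suc m)))

  liftWalk : ∀ {i j} → Star H i j → WalkOutside ｛ v ｝ (ι i) (ι j)
  liftWalk = gmap ι λ {i} {j} edge → edge , v≢ι i , v≢ι j

  liftWalk₂ : ∀ x {i j} → Star (deleteV H x) i j →
              WalkOutside (｛ v ｝ ∪ ｛ ι x ｝) (ι (punchIn x i)) (ι (punchIn x j))
  liftWalk₂ x = gmap (ι ∘ punchIn x) λ {i} {j} edge → edge , avoids i , avoids j
    where
    avoids : ∀ i → ι (punchIn x i) ∉ (｛ v ｝ ∪ ｛ ι x ｝)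
    avoids i = [ v≢ι (punchIn x i) , (λ ιx≡ → punchInᵢ≢i x i (sym (punchIn-injective v _ _ ιx≡))) ]′

  -- A free vertex other than a given one exists, as p ≤ |E| − 2.
  spareFree : (R : Config′) (x : Fin (suc (suc (suc m)))) → ∃ λ z → Free R z × z ≢ x
  spareFree R = freeVertexBesides R (s≤s (s≤s p≤))

  -- u has a neighbour in H, which is connected with at least two vertices.
  neighbourOfU : ∃ (H u)
  neighbourOfU = firstEdge (H-connected u (punchIn u zero)) (punchInᵢ≢i u zero ∘ sym)

  -- A vertex t of H can be vacated while v and an occupied vertex x ≠ t of
  -- H stay fixed: a hole travels to t inside the connected graph H − x.
  vacate : (R : Config′) (x t : Fin (suc (suc m))) → t ≢ x → (c : Fin p) → cfg R c ≡ ι x →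
           Σ Config′ λ R′ → Star (Move E) R R′ × Free R′ (ι t) × Fixes (｛ v ｝ ∪ ｛ ι x ｝) R R′
  vacate R x t t≢x c c-at-x
    with z , z-free , z≢v ← spareFree R v
    with z′ , refl ← unpunch v z z≢v
    with z″ , refl ← unpunch x z′ (λ z′≡x → z-free c (trans c-at-x (cong ι (sym z′≡x))))
    with t′ , refl ← unpunch x t t≢x
    = moveHole (liftWalk₂ x (H-2-connected x z″ t′)) R z-free

  -- A pebble can be carried along any walk of H while v stays fixed: before
  -- each step the next vertex is vacated.
  carry : ∀ {i j} → Star H i j → (R : Config′) (a : Fin p) → cfg R a ≡ ι i →
          Σ Config′ λ R′ → Star (Move E) R R′ × cfg R′ a ≡ ι j × Fixes ｛ v ｝ R R′
  carry ε R a a-at = R , ε , a-at , fixes-refl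
  carry {i} (_◅_ {j = i′} edge walk) R a a-at =
    let (R₁ , moves₁ , i′-free , fixes₁) = vacate R i i′ (edge-distinct simple edge ∘ cong ι ∘ sym) a a-at
        a-at₁ = fixes-stay fixes₁ (inj₂ refl) a-at
        (R₂ , reloc) = moveTo R₁ a (ι i′) i′-free
        (R′ , moves′ , a-at′ , fixes′) = carry walk R₂ a (arrives reloc)
    in R′ , moves₁ ◅◅ jump reloc (subst (λ z → E z (ι i′)) (sym a-at₁) edge) ◅◅ moves′ , a-at′ ,
       fixes-trans (fixes-mono inj₁ fixes₁)
         (fixes-trans (relocation-fixes reloc (subst (_∉ ｛ v ｝) (sym a-at₁) (v≢ι i)) (v≢ι i′)) fixes′)

  -- The pendant vertex can be emptied: a hole travels through H to u, then
  -- the pebble on v steps down to u.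
  clearPendant : (R : Config′) → Σ Config′ λ R′ → Star (Move E) R R′ × Free R′ v
  clearPendant R with any? (λ c → cfg R c ≟ v)
  ... | no v-free = R , ε , λ c at → v-free (c , at)
  ... | yes (c , c-at-v)
    with z , z-free , z≢v ← spareFree R v
    with z′ , refl ← unpunch v z z≢v
    with R₁ , moves₁ , u-free , fixes₁ ← moveHole (liftWalk (H-connected z′ u)) R z-free =
    let c-at-v₁ = fixes-stay fixes₁ refl c-at-v
        (R₂ , reloc) = moveTo R₁ c (ι u) u-free
    in R₂ , moves₁ ◅◅ jump reloc (subst (λ z → E z (ι u)) (sym c-at-v₁) v-u) ,
       relocates-free reloc (v≢ι u) (inj₂ c-at-v₁)

  stage : (R : Config′) (a b : Fin p) → a ≢ b → Σ Config′ λ Y → Star (Move E) R Y × cfg Y a ≡ v × cfg Y b ≡ ι u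
  stage R a b a≢b =
    let (R₁ , moves₁ , v-free₁) = clearPendant R
        (i , ιi≡) = unpunch v (cfg R₁ a) (v-free₁ a)
        (R₂ , moves₂ , a-at-u , fixes₂) = carry (H-connected i u) R₁ a (sym ιi≡)
        (R₃ , reloc) = moveTo R₂ a v (fixes-free fixes₂ refl v-free₁)
        (j , ιj≡) = unpunch v (cfg R₃ b) (λ b-at-v → a≢b (proj₂ R₃ (trans (arrives reloc) (sym b-at-v))))
        (Y , moves₄ , b-at-u , fixes₄) = carry (H-connected j u) R₃ b (sym ιj≡)
    in Y , moves₁ ◅◅ moves₂ ◅◅ jump reloc (subst (λ z → E z v) (sym a-at-u) (symE v-u)) ◅◅ moves₄ ,
       fixes-stay fixes₄ refl (arrives reloc) , b-at-u

  -- With a on v, b on a neighbour w of u and u free, a hole is brought onto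
  -- a further neighbour y of u along a walk in H − w ending at u; then the
  -- star with centre u and leaves v, w, y exchanges a and b.
  swapAround : (Y : Config′) {a b : Fin p} → a ≢ b → (w : Fin (suc (suc m))) → H u w →
               cfg Y a ≡ v → cfg Y b ≡ ι w → Free Y (ι u) → Reach Y (relabel Y (transpose a b))
  swapAround Y {a} {b} a≢b w u-w a-at-v b-at-w u-free
    with z , z-free , z≢u ← spareFree Y (ι u)
    with z′ , refl ← unpunch v z (λ z≡v → z-free a (trans a-at-v (sym z≡v)))
    with z″ , refl ← unpunch w z′ (λ z′≡w → z-free b (trans b-at-w (cong ι (sym z′≡w))))
    with u′ , refl ← unpunch w u (edge-distinct simple u-w ∘ cong ι)
    with y , walk , y-u ← approach (liftWalk₂ w (H-2-connected w z″ u′)) z≢u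
    with Y′ , moves , y-free , fixes ← moveHole walk Y z-free =
    conjugate (transpose a b) (moves⇒reach moves)
      (starSwap Y′ a≢b (fixes-free fixes (inj₂ refl) u-free) y-free
        (subst (λ x → E x (ι u)) (sym (fixes-stay fixes (inj₁ (inj₁ refl)) a-at-v)) v-u)
        (subst (λ x → E x (ι u)) (sym (fixes-stay fixes (inj₁ (inj₂ refl)) b-at-w)) (symE u-w))
        (symE y-u))

  -- From the staged position b steps aside from u to a neighbour w of u
  -- (vacated first inside H − u), which frees u for the star swap.
  swapStaged : (Y : Config′) {a b : Fin p} → a ≢ b → cfg Y a ≡ v → cfg Y b ≡ ι u →
               Reach Y (relabel Y (transpose a b))
  swapStaged Y {a} {b} a≢b a-at-v b-at-u =
    let (w , u-w) = neighbourOfU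
        (Y₁ , moves₁ , w-free , fixes₁) = vacate Y u w (edge-distinct simple u-w ∘ cong ι ∘ sym) b b-at-u
        b-at-u₁ = fixes-stay fixes₁ (inj₂ refl) b-at-u
        (Y₂ , reloc) = moveTo Y₁ b (ι w) w-free
    in conjugate (transpose a b) (moves⇒reach (moves₁ ◅◅ jump reloc (subst (λ x → E x (ι w)) (sym b-at-u₁) u-w)))
         (swapAround Y₂ a≢b w u-w (trans (stays reloc a a≢b) (fixes-stay fixes₁ (inj₁ refl) a-at-v)) (arrives reloc)
           (relocates-free reloc (edge-distinct simple u-w) (inj₂ b-at-u₁)))

  swap : ∀ R (a b : Fin p) → a ≢ b → Reach R (relabel R (transpose a b))
  swap R a b a≢b =
    let (Y , moves , a-at-v , b-at-u) = stage R a b a≢b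
    in conjugate (transpose a b) (moves⇒reach moves) (swapStaged Y a≢b a-at-v b-at-u)

  permute : ∀ R (π : Permutation′ p) → Reach R (relabel R π)
  permute = realise-permutations swap

corollary3 : ∀ {m : ℕ} (E : Graph (suc m)) → IsSimple E
    → (v : Fin (suc m)) → TwoConnected (deleteV E v) → DegreeOne E v
    → (p : ℕ) → p ≤ suc m ∸ 2
    → (S : Config p (suc m)) (Π : Permutation′ p)
    → Feasible E S Π
corollary3 {zero} E simple v () degree p p≤ S Π
corollary3 {suc zero} E simple v (s≤s () , _) degree p p≤ S Π
corollary3 {suc (suc zero)} E simple v (s≤s (s≤s ()) , _) degree p p≤ S Π
corollary3 {suc (suc (suc m))} E simple v (_ , H-connected , H-2-connected) (w , v-w , _) p p≤ S Π =
  let open Motion.Reach (Pendant.permute E simple v H-connected H-2-connected u v-u p≤ S Π)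
  in end , lands , moves
  where
  u-is-w : ∃ λ u → punchIn v u ≡ w
  u-is-w = unpunch v w (edge-distinct simple v-w ∘ sym)
  u : Fin (suc (suc (suc m)))
  u = proj₁ u-is-w
  v-u : E v (punchIn v u)
  v-u = subst (E v) (sym (proj₂ u-is-w)) v-w
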